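{- Let $s(k,q)$ be a function such that for every $k\ge 1$ and $q\ge 1$, every quasi-bipartite graph with $k$ terminals admits a quality-$q$ contraction-based cut sparsifier with $s(k,q)$ vertices. Then for every $k\ge1$ and $q\ge1$, every instance of Boolean Hypercube Contraction with $k$ terminals admits a solution of stretch at most $q$ and size at most $s(k,q)$.
   Context: Graphs may have parallel edges; each edge has unit capacity. A graph is quasi-bipartite (w.r.t. terminal set $T$) if every edge is incident to a terminal. For a partition $(T_1,T_2)$ of $T$ into non-empty subsets, $\mathrm{mincut}_G(T_1,T_2)$ is the minimum total capacity of an edge set whose removal disconnects $T_1$ from $T_2$. A contraction-based sparsifier $H$ of $G$ w.r.t. $T$ is obtained from a partition of $V(G)$ in which distinct terminals lie in distinct parts by contracting each part to a vertex (keeping parallel edges, discarding self-loops); it has quality $q$ if $\mathrm{mincut}_G(T_1,T_2)\le\mathrm{mincut}_H(T_1,T_2)\le q\,\mathrm{mincut}_G(T_1,T_2)$ for all such partitions. An instance of Boolean Hypercube Contraction (BHC) consists of a graph $G=(V,E)$ with $V=\{0,1\}^d$ and a set $T\subseteq V$ of $k$ terminals such that every edge is incident to some terminal. A solution is a map $f:V\to V$ with $f(t)=t$ for all $t\in T$; its size is $|\{f(v)\mid v\in V\}|$ and its stretch is $\frac{\sum_{(u,v)\in E}\|f(u)-f(v)\|_1}{\sum_{(u,v)\in E}\|u-v\|_1}$.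
   Formalization: The parameter q, both the quality of the sparsifiers and the bound on the stretch, ranges over the rationals, so the function $s(k,q)$ is defined only for rational q. -}

module Defs where

open import Data.Nat using (ℕ; zero; suc; _+_; _≤_)
open import Data.Bool using (Bool; true; false)
import Data.Bool as Bool
open import Data.Fin using (Fin)
import Data.Fin as Fin
open import Data.Fin.Subset using (Subset; _∈_; _∉_; ∣_∣)
open import Data.List using (List; []; _∷_; length; lookup; map; filter; deduplicate; _++_; [_])
open import Data.List.Relation.Unary.All using (All)
open import Data.Nat.ListAction using (sum)
open import Data.Vec using (Vec; []; _∷_)
open import Data.Vec.Properties using (≡-dec)
open import Data.Product using (Σ; ∃; ∃-syntax; _×_; _,_; proj₁; proj₂)
open import Data.Sum using (_⊎_)
open import Data.Integer using (+_)
open import Data.Rational using (ℚ; _/_; 1ℚ)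
import Data.Rational as ℚ
open import Function using (_∘_; Injective)
open import Relation.Binary.PropositionalEquality using (_≡_; _≢_)
open import Relation.Nullary using (¬_; ¬?)

⟦_⟧ : ℕ → ℚ
⟦ n ⟧ = + n / 1

-- Multigraphs on vertex set V: a list of edges (parallel edges = repeats)

Edges : Set → Set
Edges V = List (V × V)

Loopless : {V : Set} → Edges V → Set
Loopless E = All (λ e → proj₁ e ≢ proj₂ e) E

QuasiBipartite : {V : Set} {k : ℕ} → Edges V → (Fin k → V) → Set
QuasiBipartite {k = k} E τ =
  All (λ e → ∃[ j ] (τ j ≡ proj₁ e ⊎ τ j ≡ proj₂ e)) E

-- Cuts. A set of edges is a subset of the edge indices Fin (length E).

data Reach {n : ℕ} (E : Edges (Fin n)) (F : Subset (length E)) (u : Fin n)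
       : Fin n → Set where
  here  : Reach E F u u
  fwd   : ∀ {i} → i ∉ F → Reach E F u (proj₁ (lookup E i))
        → Reach E F u (proj₂ (lookup E i))
  bwd   : ∀ {i} → i ∉ F → Reach E F u (proj₂ (lookup E i))
        → Reach E F u (proj₁ (lookup E i))

-- A partition (T₁,T₂) of the terminals τ is given by side : Fin k → Bool
-- (T₁ = side true, T₂ = side false); both parts non-empty.
NonTrivial : {k : ℕ} → (Fin k → Bool) → Set
NonTrivial side = (∃[ i ] side i ≡ true) × (∃[ j ] side j ≡ false)

Disconnects : {n k : ℕ} (E : Edges (Fin n)) (τ : Fin k → Fin n)
              (side : Fin k → Bool) → Subset (length E) → Set
Disconnects E τ side F =
  ∀ i j → side i ≡ true → side j ≡ false → ¬ Reach E F (τ i) (τ j)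

IsMinCut : {n k : ℕ} (E : Edges (Fin n)) (τ : Fin k → Fin n)
           (side : Fin k → Bool) → ℕ → Set
IsMinCut E τ side c =
  (∃[ F ] (Disconnects E τ side F × ∣ F ∣ ≡ c))
  × (∀ F → Disconnects E τ side F → c ≤ ∣ F ∣)

-- contract along p : Fin n → Fin m (the parts are the fibres of p),
-- keeping parallel edges and discarding self-loops
contract : {n m : ℕ} → (Fin n → Fin m) → Edges (Fin n) → Edges (Fin m)
contract p E =
  filter (λ e → ¬? (proj₁ e Fin.≟ proj₂ e))
         (map (λ e → p (proj₁ e) , p (proj₂ e)) E)

Quality : {n m k : ℕ} → ℚ → Edges (Fin n) → (Fin k → Fin n)
          → Edges (Fin m) → (Fin k → Fin m) → Set
Quality {k = k} q EG τG EH τH =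
  ∀ (side : Fin k → Bool) → NonTrivial side →
  ∀ cG cH → IsMinCut EG τG side cG → IsMinCut EH τH side cH →
  cG ≤ cH × ⟦ cH ⟧ ℚ.≤ q ℚ.* ⟦ cG ⟧

SparsifierBound : ℕ → ℚ → ℕ → Set
SparsifierBound k q N =
  ∀ (n : ℕ) (E : Edges (Fin n)) (τ : Fin k → Fin n) →
  Injective _≡_ _≡_ τ → Loopless E → QuasiBipartite E τ →
  ∃[ m ] (m ≤ N × Σ (Fin n → Fin m) λ p →
     Injective _≡_ _≡_ (p ∘ τ) × Quality q E τ (contract p E) (p ∘ τ))

Cube : ℕ → Set
Cube d = Vec Bool d

-- ℓ₁ distance on {0,1}^d = Hamming distance
dist : {d : ℕ} → Cube d → Cube d → ℕ
dist [] [] = 0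
dist (true ∷ u) (true ∷ v) = dist u v
dist (false ∷ u) (false ∷ v) = dist u v
dist (true ∷ u) (false ∷ v) = suc (dist u v)
dist (false ∷ u) (true ∷ v) = suc (dist u v)

allCube : (d : ℕ) → List (Cube d)
allCube zero = [ [] ]
allCube (suc d) = map (true ∷_) (allCube d) ++ map (false ∷_) (allCube d)

size : {d : ℕ} → (Cube d → Cube d) → ℕ
size {d} f = length (deduplicate (≡-dec Bool._≟_) (map f (allCube d)))

edgeCost : {d : ℕ} → (Cube d → Cube d) → Edges (Cube d) → ℕ
edgeCost f E = sum (map (λ e → dist (f (proj₁ e)) (f (proj₂ e))) E)

-- stretch(f) ≤ q, cross-multiplied (denominator Σ‖u−v‖₁)
StretchAtMost : {d : ℕ} → (Cube d → Cube d) → Edges (Cube d) → ℚ → Set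
StretchAtMost f E q = ⟦ edgeCost f E ⟧ ℚ.≤ q ℚ.* ⟦ edgeCost (λ v → v) E ⟧

IsSolution : {d k : ℕ} → (Fin k → Cube d) → (Cube d → Cube d) → Set
IsSolution τ f = ∀ t → f (τ t) ≡ τ t

module Submission where

-- Encode {0,1}ᵈ as Fin 2ᵈ and let p be the contraction provided by the sparsifier. For each
-- coordinate i the terminals are split by their i-th bit; a minimum cut of the contracted graph
-- H for this split is a 2-colouring of its vertices, and f sends v to the vector, over all i, of
-- the colours of p v. Then f fixes the terminals and takes at most |V(H)| values. The Hamming
-- cost of f is the sum over i of these minimum cuts of H, each of which is by quality at most q
-- times the corresponding minimum cut of the encoded graph G, hence at most q times the number
-- of edges whose endpoints differ in coordinate i; summing over i gives q times the cost of the
-- identity.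

open import Defs
open import Data.Bool using (Bool; true; false; _xor_; if_then_else_)
import Data.Bool as Bool
open import Data.Bool.Properties using (xor-same; ¬-not)
open import Data.Fin using (Fin; zero; suc; funToFin; finToFun)
import Data.Fin as Fin
import Data.Fin.Properties as Finₚ
open import Data.Fin.Subset using (Subset; _∉_; _⊆_; ∣_∣)
open import Data.Fin.Subset.Properties using (_∈?_; p⊆q⇒∣p∣≤∣q∣)
open import Data.Integer using (+≤+)
import Data.Integer as ℤ
import Data.Integer.Properties as ℤ
open import Data.List using (List; []; _∷_; length; map; filter)
import Data.List as List
open import Data.List.Extrema.Nat using (argmin; argmin-all; f[argmin]≤f[xs])
open import Data.List.Membership.Propositional using () renaming (_∈_ to _∈ₗ_)
open import Data.List.Membership.Propositional.Properties
  using (∈-map⁺; ∈-map⁻; ∈-++⁺ˡ; ∈-++⁺ʳ; ∈-filter⁺; ∈-deduplicate⁻; ∈-lookup)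
open import Data.List.Relation.Unary.All as All using (All)
import Data.List.Relation.Unary.All.Properties as All
open import Data.List.Relation.Unary.AllPairs using (_∷_)
open import Data.List.Relation.Unary.Any using (here)
open import Data.List.Relation.Unary.Unique.Propositional using (Unique)
open import Data.List.Relation.Unary.Unique.DecPropositional.Properties using (deduplicate-!)
open import Data.Nat using (ℕ; zero; suc; _+_; _≤_; _<_; _^_; z≤n; s≤s; _≤?_)
open import Data.Nat.Coprimality using (1-coprimeTo)
import Data.Nat.Coprimality as Coprime
open import Data.Nat.ListAction using (sum)
import Data.Nat.Properties as ℕ
open import Algebra.Properties.CommutativeMonoid.Sum ℕ.+-0-commutativeMonoid
  using (sum-syntax; ∑-distrib-+; sum-replicate-zero; sum-cong-≗)
open import Data.Product as Product using (Σ; ∃-syntax; _×_; _,_; proj₁; proj₂)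
open import Data.Rational using (ℚ; mkℚ; 1ℚ)
import Data.Rational as ℚ
import Data.Rational.Properties as ℚ
import Data.Rational.Unnormalised as ℚᵘ
import Data.Rational.Unnormalised.Properties as ℚᵘ
open import Data.Sum as Sum using (_⊎_; inj₁; inj₂)
open import Data.Vec using ([]; _∷_; tabulate; lookup; replicate)
open import Data.Vec.Properties
  using (lookup-replicate; lookup∘tabulate; tabulate∘lookup; tabulate-cong; lookup⇒[]=; []=⇒lookup;
         ≡-dec)
open import Effect.Monad using (RawMonad)
open import Function using (_∘_; Injective)
open import Function.Bundles using (Inverse)
open import Relation.Binary.Definitions using (DecidableEquality)
open import Relation.Binary.PropositionalEquality
open import Relation.Nullary using (¬_; Dec; yes; no; does; ¬?; contradiction)
open import Relation.Nullary.Decidable using (decidable-stable; ¬¬-excluded-middle)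
open import Relation.Nullary.Negation using (¬¬-Monad)
open import Relation.Unary using (Decidable)

crossing : Bool → Bool → ℕ
crossing a b = if a xor b then 1 else 0

crossing-refl : ∀ a → crossing a a ≡ 0
crossing-refl true  = refl
crossing-refl false = refl

cutSize : {V : Set} → Edges V → (V → Bool) → ℕ
cutSize E c = sum (map (λ e → crossing (c (proj₁ e)) (c (proj₂ e))) E)

relabel : {V W : Set} → (V → W) → Edges V → Edges W
relabel φ = map (λ e → φ (proj₁ e) , φ (proj₂ e))

removeLoops : {V : Set} → DecidableEquality V → Edges V → Edges V
removeLoops _≟_ = filter (λ e → ¬? (proj₁ e ≟ proj₂ e))

module _ {V : Set} where

  cutSize-cong : ∀ (E : Edges V) {c c′ : V → Bool} → c ≗ c′ → cutSize E c ≡ cutSize E c′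
  cutSize-cong []      c≗c′ = refl
  cutSize-cong (e ∷ E) c≗c′ =
    cong₂ _+_ (cong₂ crossing (c≗c′ (proj₁ e)) (c≗c′ (proj₂ e))) (cutSize-cong E c≗c′)

  cutSize-const : ∀ (E : Edges V) b → cutSize E (λ _ → b) ≡ 0
  cutSize-const []      b = refl
  cutSize-const (e ∷ E) b = cong₂ _+_ (crossing-refl b) (cutSize-const E b)

  cutSize-removeLoops : ∀ (_≟_ : DecidableEquality V) E c →
    cutSize (removeLoops _≟_ E) c ≡ cutSize E c
  cutSize-removeLoops _≟_ []      c = refl
  cutSize-removeLoops _≟_ (e ∷ E) c with proj₁ e ≟ proj₂ e
  ... | yes u≡v rewrite u≡v | crossing-refl (c (proj₂ e)) = cutSize-removeLoops _≟_ E c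
  ... | no _    = cong (_ +_) (cutSize-removeLoops _≟_ E c)

  cutSize-relabel : ∀ {W : Set} (φ : V → W) E c → cutSize (relabel φ E) c ≡ cutSize E (c ∘ φ)
  cutSize-relabel φ []      c = refl
  cutSize-relabel φ (e ∷ E) c = cong (_ +_) (cutSize-relabel φ E c)

cutSize-contract : ∀ {V W : Set} (_≟_ : DecidableEquality W) (φ : V → W) E c →
  cutSize (removeLoops _≟_ (relabel φ E)) c ≡ cutSize E (c ∘ φ)
cutSize-contract _≟_ φ E c =
  trans (cutSize-removeLoops _≟_ (relabel φ E) c) (cutSize-relabel φ E c)

Monochromatic : {V : Set} → (V → Bool) → V × V → Set
Monochromatic c e = c (proj₁ e) ≡ c (proj₂ e)

xor≡false⇒≡ : ∀ {a b} → a xor b ≡ false → a ≡ b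
xor≡false⇒≡ {true}  {true}  _ = refl
xor≡false⇒≡ {false} {false} _ = refl

≡⇒xor≡false : ∀ {a b} → a ≡ b → a xor b ≡ false
≡⇒xor≡false {a} refl = xor-same a

cutEdges : ∀ {n} (E : Edges (Fin n)) → Subset n → Subset (length E)
cutEdges E S = tabulate λ i →
  lookup S (proj₁ (List.lookup E i)) xor lookup S (proj₂ (List.lookup E i))

∣cutEdges∣≡cutSize : ∀ {n} (E : Edges (Fin n)) S → ∣ cutEdges E S ∣ ≡ cutSize E (lookup S)
∣cutEdges∣≡cutSize []      S = refl
∣cutEdges∣≡cutSize (e ∷ E) S with lookup S (proj₁ e) xor lookup S (proj₂ e)
... | true  = cong suc (∣cutEdges∣≡cutSize E S)
... | false = ∣cutEdges∣≡cutSize E S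

module _ {n : ℕ} (E : Edges (Fin n)) (S : Subset n) where

  ∉cutEdges⇒monochromatic : ∀ {i} → i ∉ cutEdges E S → Monochromatic (lookup S) (List.lookup E i)
  ∉cutEdges⇒monochromatic {i} i∉ with lookup (cutEdges E S) i in eq
  ... | true  = contradiction (lookup⇒[]= i _ eq) i∉
  ... | false = xor≡false⇒≡ (trans (sym (lookup∘tabulate _ i)) eq)

  monochromatic⇒∉cutEdges : ∀ {i} → Monochromatic (lookup S) (List.lookup E i) → i ∉ cutEdges E S
  monochromatic⇒∉cutEdges {i} mono i∈
    with trans (sym ([]=⇒lookup i∈)) (trans (lookup∘tabulate _ i) (≡⇒xor≡false mono))
  ... | ()

  Reach-monochromatic : ∀ {u v} → Reach E (cutEdges E S) u v → lookup S u ≡ lookup S v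
  Reach-monochromatic here       = refl
  Reach-monochromatic (fwd i∉ r) = trans (Reach-monochromatic r) (∉cutEdges⇒monochromatic i∉)
  Reach-monochromatic (bwd i∉ r) = trans (Reach-monochromatic r) (sym (∉cutEdges⇒monochromatic i∉))

Separates : ∀ {n k} → (Fin k → Fin n) → (Fin k → Bool) → Subset n → Set
Separates τ side S = ∀ t → lookup S (τ t) ≡ side t

separating? : ∀ {n k} (τ : Fin k → Fin n) side → Decidable (Separates τ side)
separating? τ side S = Finₚ.all? λ t → lookup S (τ t) Bool.≟ side t

separating⇒disconnects : ∀ {n k} (E : Edges (Fin n)) τ (side : Fin k → Bool) S →
  Separates τ side S → Disconnects E τ side (cutEdges E S)
separating⇒disconnects E τ side S sep i j i∈T₁ j∈T₂ τi~τj
  with trans (sym (trans (sep i) i∈T₁)) (trans (Reach-monochromatic E S τi~τj) (trans (sep j) j∈T₂))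
... | ()

module _ {n k : ℕ} (E : Edges (Fin n)) (τ : Fin k → Fin n) (side : Fin k → Bool)
         {F : Subset (length E)} (disconnects : Disconnects E τ side F) where

  private
    ReachableFromT₁ : Fin n → Set
    ReachableFromT₁ v = ∃[ t ] (side t ≡ true × Reach E F (τ t) v)

    module _ (reachable? : Decidable ReachableFromT₁) where

      reachableSet : Subset n
      reachableSet = tabulate (does ∘ reachable?)

      reachableSet-separates : Separates τ side reachableSet
      reachableSet-separates t =
        trans (lookup∘tabulate _ (τ t)) (classify (reachable? (τ t)) (side t) refl)
        where
        classify : (r? : Dec (ReachableFromT₁ (τ t))) (b : Bool) → side t ≡ b → does r? ≡ side t
        classify (yes _)              true  t∈T₁ = sym t∈T₁
        classify (yes (s , s∈T₁ , r)) false t∈T₂ = contradiction r (disconnects s t s∈T₁ t∈T₂)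
        classify (no ¬r)              true  t∈T₁ = contradiction (t , t∈T₁ , here) ¬r
        classify (no _)               false t∈T₂ = sym t∈T₂

      reachableSet-monochromatic : ∀ {i} → i ∉ F →
        Monochromatic (lookup reachableSet) (List.lookup E i)
      reachableSet-monochromatic {i} i∉F
        rewrite lookup∘tabulate (does ∘ reachable?) (proj₁ (List.lookup E i))
              | lookup∘tabulate (does ∘ reachable?) (proj₂ (List.lookup E i))
        with reachable? (proj₁ (List.lookup E i)) | reachable? (proj₂ (List.lookup E i))
      ... | yes _              | yes _               = refl
      ... | no _               | no _                = refl
      ... | yes (t , t∈T₁ , r) | no ¬r′              = contradiction (t , t∈T₁ , fwd i∉F r) ¬r′
      ... | no ¬r              | yes (t , t∈T₁ , r′) = contradiction (t , t∈T₁ , bwd i∉F r′) ¬r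

      cutEdges-reachableSet⊆ : cutEdges E reachableSet ⊆ F
      cutEdges-reachableSet⊆ {i} i∈cut with i ∈? F
      ... | yes i∈F = i∈F
      ... | no  i∉F = contradiction i∈cut
                        (monochromatic⇒∉cutEdges E reachableSet (reachableSet-monochromatic i∉F))

  -- Reachability is not decided constructively here, but for a decidable goal it suffices to
  -- assume excluded middle for each of the finitely many vertices.
  disconnecting⇒¬¬separatingCut⊆ : ¬ ¬ (∃[ S ] (Separates τ side S × cutEdges E S ⊆ F))
  disconnecting⇒¬¬separatingCut⊆ ¬∃S =
    Finₚ.sequence (RawMonad.rawApplicative ¬¬-Monad) (λ _ → ¬¬-excluded-middle) λ reachable? →
      ¬∃S (reachableSet reachable? , reachableSet-separates reachable? ,
           cutEdges-reachableSet⊆ reachable?)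

module _ {n k : ℕ} (E : Edges (Fin n)) {τ : Fin k → Fin n} {side : Fin k → Bool} where

  isMinCut⇒≤cutSize : ∀ {c} → IsMinCut E τ side c →
    ∀ S → Separates τ side S → c ≤ cutSize E (lookup S)
  isMinCut⇒≤cutSize (_ , minimal) S sep = subst (_ ≤_) (∣cutEdges∣≡cutSize E S)
    (minimal (cutEdges E S) (separating⇒disconnects E τ side S sep))

  minimalSeparating⇒isMinCut : ∀ S → Separates τ side S →
    (∀ S′ → Separates τ side S′ → cutSize E (lookup S) ≤ cutSize E (lookup S′)) →
    IsMinCut E τ side (cutSize E (lookup S))
  minimalSeparating⇒isMinCut S sep minimal =
    (cutEdges E S , separating⇒disconnects E τ side S sep , ∣cutEdges∣≡cutSize E S) , lowerBound
    where
    lowerBound : ∀ F → Disconnects E τ side F → cutSize E (lookup S) ≤ ∣ F ∣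
    lowerBound F disc = decidable-stable (_ ≤? _) λ S≰F →
      disconnecting⇒¬¬separatingCut⊆ E τ side disc λ (S′ , sep′ , cut⊆F) →
        S≰F (ℕ.≤-trans (minimal S′ sep′)
              (subst (_≤ ∣ F ∣) (∣cutEdges∣≡cutSize E S′) (p⊆q⇒∣p∣≤∣q∣ cut⊆F)))

∈-allCube : ∀ d (v : Cube d) → v ∈ₗ allCube d
∈-allCube zero    []          = here refl
∈-allCube (suc d) (true ∷ v)  = ∈-++⁺ˡ (∈-map⁺ (true ∷_) (∈-allCube d v))
∈-allCube (suc d) (false ∷ v) =
  ∈-++⁺ʳ (map (true ∷_) (allCube d)) (∈-map⁺ (false ∷_) (∈-allCube d v))

module _ {n k : ℕ} {τ : Fin k → Fin n} (τ-injective : Injective _≡_ _≡_ τ)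
         (side : Fin k → Bool) where

  private
    terminalSide : Fin n → Bool
    terminalSide v with Finₚ.any? (λ t → τ t Fin.≟ v)
    ... | yes (t , _) = side t
    ... | no _        = false

    terminalSide-τ : ∀ t → terminalSide (τ t) ≡ side t
    terminalSide-τ t with Finₚ.any? (λ t′ → τ t′ Fin.≟ τ t)
    ... | yes (t′ , τt′≡τt) = cong side (τ-injective τt′≡τt)
    ... | no ¬∃t′          = contradiction (t , refl) ¬∃t′

    separatingColourings : List (Subset n)
    separatingColourings = filter (separating? τ side) (allCube n)

  terminalColouring : Subset n
  terminalColouring = tabulate terminalSide

  terminalColouring-separates : Separates τ side terminalColouring
  terminalColouring-separates t = trans (lookup∘tabulate terminalSide (τ t)) (terminalSide-τ t)

  minCutColouring : Edges (Fin n) → Subset n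
  minCutColouring E = argmin (cutSize E ∘ lookup) terminalColouring separatingColourings

  module _ (E : Edges (Fin n)) where

    minCutColouring-separates : Separates τ side (minCutColouring E)
    minCutColouring-separates = argmin-all (cutSize E ∘ lookup) terminalColouring-separates
      (All.all-filter (separating? τ side) (allCube n))

    minCutColouring-isMinCut : IsMinCut E τ side (cutSize E (lookup (minCutColouring E)))
    minCutColouring-isMinCut =
      minimalSeparating⇒isMinCut E (minCutColouring E) minCutColouring-separates λ S sep →
        All.lookup (f[argmin]≤f[xs] terminalColouring separatingColourings)
                   (∈-filter⁺ (separating? τ side) (∈-allCube n S) sep)

dist≡∑crossing : ∀ {d} (u v : Cube d) → dist u v ≡ ∑[ i < d ] crossing (lookup u i) (lookup v i)
dist≡∑crossing []          []          = refl
dist≡∑crossing (true ∷ u)  (true ∷ v)  = dist≡∑crossing u v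
dist≡∑crossing (false ∷ u) (false ∷ v) = dist≡∑crossing u v
dist≡∑crossing (true ∷ u)  (false ∷ v) = cong suc (dist≡∑crossing u v)
dist≡∑crossing (false ∷ u) (true ∷ v)  = cong suc (dist≡∑crossing u v)

edgeCost≡∑cutSize : ∀ {d} (f : Cube d → Cube d) E →
  edgeCost f E ≡ ∑[ i < d ] cutSize E (λ v → lookup (f v) i)
edgeCost≡∑cutSize {d} f []      = sym (sum-replicate-zero d)
edgeCost≡∑cutSize {d} f (e ∷ E) = begin
  dist (f u) (f v) + edgeCost f E                        ≡⟨ cong₂ _+_ (dist≡∑crossing (f u) (f v))
                                                                      (edgeCost≡∑cutSize f E) ⟩
  ∑[ i < d ] crossingAt i + ∑[ i < d ] cutSizeAt i       ≡⟨ ∑-distrib-+ crossingAt cutSizeAt ⟨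
  ∑[ i < d ] cutSize (e ∷ E) (λ w → lookup (f w) i)      ∎
  where
  open ≡-Reasoning
  u = proj₁ e
  v = proj₂ e
  crossingAt cutSizeAt : Fin d → ℕ
  crossingAt i = crossing (lookup (f u) i) (lookup (f v) i)
  cutSizeAt i = cutSize E (λ w → lookup (f w) i)

module _ {d : ℕ} where

  private
    module 2↔Bool = Inverse Finₚ.2↔Bool

  encode : Cube d → Fin (2 ^ d)
  encode v = funToFin (2↔Bool.from ∘ lookup v)

  coordinate : Fin d → Fin (2 ^ d) → Bool
  coordinate i x = 2↔Bool.to (finToFun x i)

  coordinate-encode : ∀ i v → coordinate i (encode v) ≡ lookup v i
  coordinate-encode i v =
    trans (cong 2↔Bool.to (Finₚ.finToFun-funToFin (2↔Bool.from ∘ lookup v) i))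
          (2↔Bool.strictlyInverseˡ (lookup v i))

  encode-injective : Injective _≡_ _≡_ encode
  encode-injective {u} {v} eq = begin
    u                   ≡⟨ tabulate∘lookup u ⟨
    tabulate (lookup u) ≡⟨ tabulate-cong (λ i → trans (sym (coordinate-encode i u))
                             (trans (cong (coordinate i) eq) (coordinate-encode i v))) ⟩
    tabulate (lookup v) ≡⟨ tabulate∘lookup v ⟩
    v                   ∎
    where open ≡-Reasoning

  coordinateColouring : Fin d → Subset (2 ^ d)
  coordinateColouring i = tabulate (coordinate i)

  lookup-coordinateColouring : ∀ i v → lookup (coordinateColouring i) (encode v) ≡ lookup v i
  lookup-coordinateColouring i v = trans (lookup∘tabulate (coordinate i) (encode v)) (coordinate-encode i v)

Unique⇒lookup-distinct : ∀ {A : Set} {xs : List A} → Unique xs →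
  ∀ {i j} → i Fin.< j → List.lookup xs i ≢ List.lookup xs j
Unique⇒lookup-distinct {xs = _ ∷ xs} (x∉xs ∷ _) {zero}  {suc j} _ =
  All.lookup x∉xs (∈-lookup {xs = xs} j)
Unique⇒lookup-distinct {xs = _ ∷ _} (_ ∷ unique) {suc i} {suc j} (s≤s i<j) =
  Unique⇒lookup-distinct unique i<j

Unique-in-image⇒length≤ : ∀ {A : Set} {m} (g : Fin m → A) {xs : List A} → Unique xs →
  (∀ {x} → x ∈ₗ xs → ∃[ a ] x ≡ g a) → length xs ≤ m
Unique-in-image⇒length≤ {m = m} g {xs} unique inImage = ℕ.≮⇒≥ m≮length
  where
  preimage : ∀ j → ∃[ a ] List.lookup xs j ≡ g a
  preimage j = inImage (∈-lookup j)

  m≮length : ¬ m < length xs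
  m≮length m<length with Finₚ.pigeonhole m<length (proj₁ ∘ preimage)
  ... | i , j , i<j , same = Unique⇒lookup-distinct unique i<j
    (trans (proj₂ (preimage i)) (trans (cong g same) (sym (proj₂ (preimage j)))))

size-∘≤ : ∀ {d m} (g : Fin m → Cube d) (h : Cube d → Fin m) → size (g ∘ h) ≤ m
size-∘≤ {d} g h = Unique-in-image⇒length≤ g (deduplicate-! _≟_ values) λ x∈ →
  let v , _ , x≡ghv = ∈-map⁻ (g ∘ h) (∈-deduplicate⁻ _≟_ values x∈) in h v , x≡ghv
  where
  _≟_ = ≡-dec Bool._≟_
  values = map (g ∘ h) (allCube d)

⟦⟧≡mkℚ : ∀ n → ⟦ n ⟧ ≡ mkℚ (ℤ.+ n) 0 (Coprime.sym (1-coprimeTo n))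
⟦⟧≡mkℚ n = ℚ.normalize-coprime (Coprime.sym (1-coprimeTo n))

⟦⟧-mono-≤ : ∀ {a b} → a ≤ b → ⟦ a ⟧ ℚ.≤ ⟦ b ⟧
⟦⟧-mono-≤ {a} {b} a≤b rewrite ⟦⟧≡mkℚ a | ⟦⟧≡mkℚ b =
  ℚ.*≤* (ℤ.*-monoʳ-≤-nonNeg (ℤ.+ 1) (+≤+ a≤b))

⟦⟧-homo-+ : ∀ a b → ⟦ a + b ⟧ ≡ ⟦ a ⟧ ℚ.+ ⟦ b ⟧
⟦⟧-homo-+ a b = ℚ.toℚᵘ-injective (begin
  ℚ.toℚᵘ ⟦ a + b ⟧                         ≡⟨ toℚᵘ-⟦⟧ (a + b) ⟩
  ℚᵘ.mkℚᵘ (ℤ.+ (a + b)) 0                   ≈⟨ ℚᵘ.*≡* (cong (ℤ._* ℤ.+ 1) numerator) ⟩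
  ℚᵘ.mkℚᵘ (ℤ.+ a) 0 ℚᵘ.+ ℚᵘ.mkℚᵘ (ℤ.+ b) 0  ≡⟨ cong₂ ℚᵘ._+_ (toℚᵘ-⟦⟧ a) (toℚᵘ-⟦⟧ b) ⟨
  ℚ.toℚᵘ ⟦ a ⟧ ℚᵘ.+ ℚ.toℚᵘ ⟦ b ⟧            ≈⟨ ℚ.toℚᵘ-homo-+ ⟦ a ⟧ ⟦ b ⟧ ⟨
  ℚ.toℚᵘ (⟦ a ⟧ ℚ.+ ⟦ b ⟧)                  ∎)
  where
  open ℚᵘ.≃-Reasoning
  toℚᵘ-⟦⟧ : ∀ n → ℚ.toℚᵘ ⟦ n ⟧ ≡ ℚᵘ.mkℚᵘ (ℤ.+ n) 0
  toℚᵘ-⟦⟧ n = cong ℚ.toℚᵘ (⟦⟧≡mkℚ n)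
  numerator : ℤ.+ (a + b) ≡ ℤ.+ a ℤ.* ℤ.+ 1 ℤ.+ ℤ.+ b ℤ.* ℤ.+ 1
  numerator = trans (ℤ.pos-+ a b)
    (sym (cong₂ ℤ._+_ (ℤ.*-identityʳ (ℤ.+ a)) (ℤ.*-identityʳ (ℤ.+ b))))

⟦⟧-nonNeg : ∀ n → ℚ.NonNegative ⟦ n ⟧
⟦⟧-nonNeg n = ℚ.nonNegative (⟦⟧-mono-≤ {0} {n} z≤n)

1≤q⇒nonNeg : ∀ {q} → 1ℚ ℚ.≤ q → ℚ.NonNegative q
1≤q⇒nonNeg 1≤q = ℚ.nonNegative (ℚ.≤-trans (⟦⟧-mono-≤ {0} {1} z≤n) 1≤q)

⟦⟧≤q*⟦⟧ : ∀ {q} → 1ℚ ℚ.≤ q → ∀ n → ⟦ n ⟧ ℚ.≤ q ℚ.* ⟦ n ⟧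
⟦⟧≤q*⟦⟧ {q} 1≤q n = subst (ℚ._≤ q ℚ.* ⟦ n ⟧) (ℚ.*-identityˡ ⟦ n ⟧)
  (ℚ.*-monoʳ-≤-nonNeg ⟦ n ⟧ {{⟦⟧-nonNeg n}} 1≤q)

∑-≤-scaled : ∀ q .{{_ : ℚ.NonNegative q}} {d} (a b : Fin d → ℕ) →
  (∀ i → ⟦ a i ⟧ ℚ.≤ q ℚ.* ⟦ b i ⟧) → ⟦ ∑[ i < d ] a i ⟧ ℚ.≤ q ℚ.* ⟦ ∑[ i < d ] b i ⟧
∑-≤-scaled q {zero}  a b a≤qb = ℚ.≤-reflexive (sym (ℚ.*-zeroʳ q))
∑-≤-scaled q {suc d} a b a≤qb = begin
  ⟦ a zero + Σa ⟧                      ≡⟨ ⟦⟧-homo-+ (a zero) Σa ⟩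
  ⟦ a zero ⟧ ℚ.+ ⟦ Σa ⟧                ≤⟨ ℚ.+-mono-≤ (a≤qb zero)
                                            (∑-≤-scaled q (a ∘ suc) (b ∘ suc) (a≤qb ∘ suc)) ⟩
  q ℚ.* ⟦ b zero ⟧ ℚ.+ q ℚ.* ⟦ Σb ⟧    ≡⟨ ℚ.*-distribˡ-+ q ⟦ b zero ⟧ ⟦ Σb ⟧ ⟨
  q ℚ.* (⟦ b zero ⟧ ℚ.+ ⟦ Σb ⟧)        ≡⟨ cong (q ℚ.*_) (⟦⟧-homo-+ (b zero) Σb) ⟨
  q ℚ.* ⟦ b zero + Σb ⟧                ∎
  where
  open ℚ.≤-Reasoning
  Σa = ∑[ i < d ] a (suc i)
  Σb = ∑[ i < d ] b (suc i)

nonTrivial-or-constant : ∀ {k} (side : Fin k → Bool) →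
  NonTrivial side ⊎ ∃[ b ] (∀ t → side t ≡ b)
nonTrivial-or-constant side
  with Finₚ.any? (λ t → side t Bool.≟ true) | Finₚ.any? (λ t → side t Bool.≟ false)
... | yes T₁≢∅ | yes T₂≢∅ = inj₁ (T₁≢∅ , T₂≢∅)
... | no T₁≡∅  | _         = inj₂ (false , λ t → ¬-not (λ t∈T₁ → T₁≡∅ (t , t∈T₁)))
... | yes _    | no T₂≡∅   = inj₂ (true , λ t → ¬-not (λ t∈T₂ → T₂≡∅ (t , t∈T₂)))

-- Quality only constrains partitions with both parts non-empty; for the remaining ones the
-- constant colouring shows that the minimum cut of H is 0.
minCut-quality : ∀ {n m k q} {EG : Edges (Fin n)} {τG : Fin k → Fin n}
                 {EH : Edges (Fin m)} {τH : Fin k → Fin m} →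
  1ℚ ℚ.≤ q → Quality q EG τG EH τH → ∀ side {cG cH} →
  IsMinCut EG τG side cG → IsMinCut EH τH side cH → ⟦ cH ⟧ ℚ.≤ q ℚ.* ⟦ cG ⟧
minCut-quality {m = m} {EH = EH} {τH} 1≤q quality side {cG} {cH} mcG mcH
  with nonTrivial-or-constant side
... | inj₁ nonTrivial     = proj₂ (quality side nonTrivial cG cH mcG mcH)
... | inj₂ (b , constant) =
  ℚ.≤-trans (⟦⟧-mono-≤ {cH} {cG} (ℕ.≤-trans cH≤0 z≤n)) (⟦⟧≤q*⟦⟧ 1≤q cG)
  where
  cH≤0 : cH ≤ 0
  cH≤0 = subst (cH ≤_) (trans (cutSize-cong EH (λ v → lookup-replicate v b)) (cutSize-const EH b))
    (isMinCut⇒≤cutSize EH mcH (replicate m b) λ t →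
      trans (lookup-replicate (τH t) b) (sym (constant t)))

-- Loops are dropped because sparsifiers are only provided for loopless graphs; they cost nothing.
encodedGraph : ∀ {d} → Edges (Cube d) → Edges (Fin (2 ^ d))
encodedGraph E = removeLoops Fin._≟_ (relabel encode E)

encodedGraph-loopless : ∀ {d} (E : Edges (Cube d)) → Loopless (encodedGraph E)
encodedGraph-loopless E = All.all-filter _ (relabel encode E)

encodedGraph-quasiBipartite : ∀ {d k} {E : Edges (Cube d)} {τ : Fin k → Cube d} →
  QuasiBipartite E τ → QuasiBipartite (encodedGraph E) (encode ∘ τ)
encodedGraph-quasiBipartite qb =
  All.filter⁺ _ (All.map⁺ (All.map (Product.map₂ (Sum.map (cong encode) (cong encode))) qb))

edgeCost-id≡∑cutSize : ∀ {d} (E : Edges (Cube d)) →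
  edgeCost (λ v → v) E ≡ ∑[ i < d ] cutSize (encodedGraph E) (lookup (coordinateColouring i))
edgeCost-id≡∑cutSize E = trans (edgeCost≡∑cutSize (λ v → v) E) (sum-cong-≗ λ i → sym (begin
  cutSize (encodedGraph E) (lookup (coordinateColouring i))
    ≡⟨ cutSize-contract Fin._≟_ encode E (lookup (coordinateColouring i)) ⟩
  cutSize E (lookup (coordinateColouring i) ∘ encode)
    ≡⟨ cutSize-cong E (lookup-coordinateColouring i) ⟩
  cutSize E (λ v → lookup v i)
    ∎))
  where open ≡-Reasoning

coordinateSide : ∀ {d k} → (Fin k → Cube d) → Fin d → Fin k → Bool
coordinateSide τ i t = lookup (τ t) i

module ContractionSolution
  {d k : ℕ} (E : Edges (Cube d)) {τ : Fin k → Cube d} (τ-injective : Injective _≡_ _≡_ τ)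
  {m : ℕ} (p : Fin (2 ^ d) → Fin m) (p-injective : Injective _≡_ _≡_ (p ∘ encode ∘ τ)) where

  G : Edges (Fin (2 ^ d))
  G = encodedGraph E

  H : Edges (Fin m)
  H = contract p G

  side : Fin d → Fin k → Bool
  side = coordinateSide τ

  minCutᴳ : Fin d → Subset (2 ^ d)
  minCutᴳ i = minCutColouring (τ-injective ∘ encode-injective) (side i) G

  minCutᴳ-isMinCut : ∀ i → IsMinCut G (encode ∘ τ) (side i) (cutSize G (lookup (minCutᴳ i)))
  minCutᴳ-isMinCut i = minCutColouring-isMinCut (τ-injective ∘ encode-injective) (side i) G

  minCutᴴ : Fin d → Subset m
  minCutᴴ i = minCutColouring p-injective (side i) H

  readOff : Fin m → Cube d
  readOff a = tabulate λ i → lookup (minCutᴴ i) a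

  f : Cube d → Cube d
  f = readOff ∘ p ∘ encode

  f-isSolution : IsSolution τ f
  f-isSolution t = trans (tabulate-cong λ i → minCutColouring-separates p-injective (side i) H t)
                         (tabulate∘lookup (τ t))

  size-f≤m : size f ≤ m
  size-f≤m = size-∘≤ readOff (p ∘ encode)

  edgeCost-f : edgeCost f E ≡ ∑[ i < d ] cutSize H (lookup (minCutᴴ i))
  edgeCost-f = trans (edgeCost≡∑cutSize f E) (sum-cong-≗ λ i → begin
    cutSize E (λ v → lookup (f v) i)
      ≡⟨ cutSize-cong E (λ v → lookup∘tabulate _ i) ⟩
    cutSize E (lookup (minCutᴴ i) ∘ p ∘ encode)
      ≡⟨ cutSize-contract Fin._≟_ encode E (lookup (minCutᴴ i) ∘ p) ⟨
    cutSize G (lookup (minCutᴴ i) ∘ p)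
      ≡⟨ cutSize-contract Fin._≟_ p G (lookup (minCutᴴ i)) ⟨
    cutSize H (lookup (minCutᴴ i))
      ∎)
    where open ≡-Reasoning

  coordinateColouring-separates : ∀ i → Separates (encode ∘ τ) (side i) (coordinateColouring i)
  coordinateColouring-separates i t = lookup-coordinateColouring i (τ t)

  module _ {q : ℚ} (1≤q : 1ℚ ℚ.≤ q) where

    private
      q≥0 : ℚ.NonNegative q
      q≥0 = 1≤q⇒nonNeg 1≤q

    module _ (quality : Quality q G (encode ∘ τ) H (p ∘ encode ∘ τ)) where

      minCutᴴ≤q*coordinateCut : ∀ i →
        ⟦ cutSize H (lookup (minCutᴴ i)) ⟧ ℚ.≤ q ℚ.* ⟦ cutSize G (lookup (coordinateColouring i)) ⟧
      minCutᴴ≤q*coordinateCut i = ℚ.≤-trans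
        (minCut-quality 1≤q quality (side i) (minCutᴳ-isMinCut i)
          (minCutColouring-isMinCut p-injective (side i) H))
        (ℚ.*-monoˡ-≤-nonNeg q {{q≥0}} (⟦⟧-mono-≤
          (isMinCut⇒≤cutSize G (minCutᴳ-isMinCut i)
             (coordinateColouring i) (coordinateColouring-separates i))))

      f-stretch : StretchAtMost f E q
      f-stretch = subst₂ (λ a b → ⟦ a ⟧ ℚ.≤ q ℚ.* ⟦ b ⟧) (sym edgeCost-f) (sym (edgeCost-id≡∑cutSize E))
        (∑-≤-scaled q {{q≥0}} _ _ minCutᴴ≤q*coordinateCut)

lemma6p1 : (s : ℕ → ℚ → ℕ) →
    (∀ (k : ℕ) (q : ℚ) → 1 ≤ k → 1ℚ ℚ.≤ q → SparsifierBound k q (s k q)) →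
    ∀ (k : ℕ) (q : ℚ) → 1 ≤ k → 1ℚ ℚ.≤ q →
    ∀ (d : ℕ) (E : Edges (Cube d)) (τ : Fin k → Cube d) →
    Injective _≡_ _≡_ τ → QuasiBipartite E τ →
    Σ (Cube d → Cube d) λ f →
    IsSolution τ f × StretchAtMost f E q × size f ≤ s k q
lemma6p1 s sparsifier k q 1≤k 1≤q d E τ τ-injective quasiBipartite
  with sparsifier k q 1≤k 1≤q (2 ^ d) (encodedGraph E) (encode ∘ τ) (τ-injective ∘ encode-injective)
                  (encodedGraph-loopless E) (encodedGraph-quasiBipartite quasiBipartite)
... | m , m≤s , p , p-injective , quality =
  f , f-isSolution , f-stretch 1≤q quality , ℕ.≤-trans size-f≤m m≤s
  where open ContractionSolution E τ-injective p p-injective
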